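{- Let $G$ be a regular graph and let $k < \Delta(G)/2$. Suppose every edge precoloring of $G$ with colors from $\{1,\dots,\chi'(G)\}$ whose precolored edges are at most $k$ independent edges is extendable to a proper $\chi'(G)$-edge coloring of $G$. Then every edge precoloring of $G \square K_2$ with colors from $\{1,\dots,\chi'(G)+1\}$ whose precolored edges are at most $k+1$ independent edges is extendable to a proper $(\chi'(G)+1)$-edge coloring of $G \square K_2$.
   Context: $G \square H$ denotes the cartesian product of graphs. $\chi'(G)$ is the chromatic index and $\Delta(G)$ the maximum degree. Independent edges means pairwise non-adjacent edges (a matching). An edge precoloring is a proper edge coloring of some subset of the edges; it is extendable to a proper $t$-edge coloring if there is a proper edge coloring $f$ with colors $\{1,\dots,t\}$ agreeing with it on all precolored edges. -}

module Defs where

open import Data.Nat using (ℕ; zero; suc; _+_; _⊔_; _≤_)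
open import Data.Bool using (Bool; true; false; T; _∧_; _∨_; not; if_then_else_)
open import Data.Fin using (Fin; remQuot; _≟_)
open import Data.List using (List; map; foldr; allFin; length)
open import Data.Nat.ListAction using (sum)
open import Data.List.Relation.Unary.All using (All)
open import Data.List.Relation.Unary.AllPairs using (AllPairs)
open import Data.Product using (_×_; _,_; Σ; ∃)
open import Relation.Nullary using (¬_)
open import Relation.Nullary.Decidable using (⌊_⌋)
open import Relation.Binary.PropositionalEquality using (_≡_; _≢_)

record Graph : Set where
  field
    n   : ℕ
    adj : Fin n → Fin n → Bool
open Graph public

Adj : (G : Graph) → Fin (n G) → Fin (n G) → Set
Adj G u v = T (adj G u v)

IsSimple : Graph → Set
IsSimple G = (∀ u v → Adj G u v → Adj G v u) × (∀ u → ¬ Adj G u u)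

deg : (G : Graph) → Fin (n G) → ℕ
deg G u = sum (map (λ v → if adj G u v then 1 else 0) (allFin (n G)))

Δ : Graph → ℕ
Δ G = foldr _⊔_ 0 (map (deg G) (allFin (n G)))

Regular : Graph → Set
Regular G = ∀ u v → deg G u ≡ deg G v

-- An edge coloring with t colors (Fin t stands for {1,…,t}),
-- assigning a color to every edge {u,v}; defined on ordered pairs
-- and required to be symmetric.
EdgeColoring : Graph → ℕ → Set
EdgeColoring G t = (u v : Fin (n G)) → Adj G u v → Fin t

IsProper : (G : Graph) {t : ℕ} → EdgeColoring G t → Set
IsProper G f =
  (∀ u v (p : Adj G u v) (q : Adj G v u) → f u v p ≡ f v u q) ×
  (∀ u v w (p : Adj G u v) (q : Adj G u w) → v ≢ w → f u v p ≢ f u w q)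

Colorable : Graph → ℕ → Set
Colorable G t = Σ (EdgeColoring G t) (IsProper G)

IsChromaticIndex : Graph → ℕ → Set
IsChromaticIndex G χ = Colorable G χ × (∀ t → Colorable G t → χ ≤ t)

Precoloring : Graph → ℕ → Set
Precoloring G t = List (Fin (n G) × Fin (n G) × Fin t)

DisjointEdges : {G : Graph} {t : ℕ} → (Fin (n G) × Fin (n G) × Fin t) → (Fin (n G) × Fin (n G) × Fin t) → Set
DisjointEdges (u , v , _) (u' , v' , _) = u ≢ u' × u ≢ v' × v ≢ u' × v ≢ v'

IndependentPrecoloring : (G : Graph) {t : ℕ} → Precoloring G t → Set
IndependentPrecoloring G {t} P =
  All (λ { (u , v , _) → Adj G u v }) P × AllPairs (DisjointEdges {G} {t}) P

Extendable : (G : Graph) (t : ℕ) → Precoloring G t → Set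
Extendable G t P = Σ (EdgeColoring G t) λ f → IsProper G f ×
  All (λ { (u , v , c) → (p : Adj G u v) → f u v p ≡ c }) P

-- Cartesian product G □ K₂ on vertex set Fin (n * 2), vertex i ↔ remQuot 2 i = (a , x)
_□K₂ : Graph → Graph
G □K₂ = record { n = n G Data.Nat.* 2 ; adj = a }
  where
  a : Fin (n G Data.Nat.* 2) → Fin (n G Data.Nat.* 2) → Bool
  a i j with remQuot 2 i | remQuot {n G} 2 j
  ... | (u , x) | (v , y) = (⌊ u ≟ v ⌋ ∧ not ⌊ x ≟ y ⌋) ∨ (⌊ x ≟ y ⌋ ∧ adj G u v)

{-# OPTIONS --safe #-}
-- Let s be a spare colour among the χ + 1. Two proper χ-edge-colourings f₀, f₁ of G that agree on a matching M
-- lift to a proper (χ + 1)-edge-colouring of G □ K₂: in layer x an edge uv gets s if uv ∈ M and f_x(uv),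
-- renumbered around s, otherwise; the rung at u gets the renumbered f₀-colour of the M-edge at u, or s if u is
-- unmatched.
-- A precoloured rung at u of colour c ≠ s is realised through a neighbour w of u avoiding all other precoloured
-- vertices (one exists as G is regular and 2k < Δ): uw joins M and is precoloured c in both layers; if c = s, u
-- stays unmatched. Precoloured layer edges of colour s join M, the others stay precoloured in their layer. If both
-- layers carry precoloured edges, s is chosen unused by them, so each layer receives at most k precoloured edges;
-- if only one does, take f₀ = f₁ and let s be the colour of some precoloured edge, which then costs nothing.
module Submission where

open import Defs
open import Data.Nat using (ℕ; zero; suc; _+_; _*_; _<_; _≤_; _⊔_; z≤n; s≤s)
open import Data.Nat.Properties
  using (≤-refl; ≤-trans; ≤-reflexive; ≤-pred; <⇒≱; ⊔-lub; +-suc; +-comm; +-identityʳ; +-mono-≤; +-monoʳ-≤;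
         m≤m+n; m≤n*m; +-commutativeSemigroup; module ≤-Reasoning)
open import Data.Nat.Tactic.RingSolver using (solve-∀)
open import Algebra.Properties.CommutativeSemigroup +-commutativeSemigroup using (xy∙z≈xz∙y)
open import Data.Nat.ListAction using (sum)
open import Data.Bool using (Bool; true; false; T; if_then_else_; _∧_; _∨_; not)
open import Data.Bool.Properties using (∧-zeroʳ; T-irrelevant)
open import Data.Maybe using (Maybe; just; nothing)
open import Data.Maybe.Properties using (just-injective; ≡-dec)
open import Data.Product using (Σ; _×_; _,_; proj₁; proj₂; ∃-syntax; uncurry)
open import Data.Sum as Sum using (_⊎_; inj₁; inj₂; [_,_]′)
open import Data.Empty using (⊥-elim)
open import Function using (_∘_)
open import Data.Unit using (⊤; tt)
open import Data.List using (List; []; _∷_; _++_; length; filter; mapMaybe; map; foldr; allFin)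
open import Data.List.Properties
  using (filter-notAll; filter-none; length-mapMaybe; length-tabulate; length-map; length-++; ++-identityʳ)
open import Data.Fin using (Fin; zero; suc; _≟_; remQuot; combine; punchIn; punchOut)
open import Data.Fin.Properties using (combine-remQuot; punchInᵢ≢i; punchIn-injective; punchIn-punchOut)
open import Data.List.Relation.Unary.All as All using (All; [] ; _∷_)
import Data.List.Relation.Unary.All.Properties as Allₚ
open Allₚ using (¬Any⇒All¬; all-filter)
open import Data.List.Relation.Unary.Any as Any using (here; there; any?)
open import Data.List.Relation.Unary.AllPairs using (AllPairs; []; _∷_)
import Data.List.Relation.Unary.AllPairs.Properties as AllPairsₚ
open import Data.List.Relation.Unary.Unique.Propositional using (Unique)
open import Data.List.Relation.Unary.Unique.Propositional.Properties using (allFin⁺) renaming (filter⁺ to Unique-filter⁺)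
open import Data.List.Relation.Binary.Subset.Propositional using (_⊆_)
import Data.List.Relation.Binary.Subset.Propositional.Properties as Subset
open import Data.List.Membership.Propositional using (_∈_; _∉_; find)
open import Data.List.Membership.Propositional.Properties
  using (∈-filter⁺; ∈-filter⁻; ∈-allFin; ∈-++⁻; ∈-++⁺ˡ; ∈-++⁺ʳ; ∈-map⁺)
import Data.List.Membership.DecPropositional as DecMembership
open import Relation.Nullary using (¬_; Dec; yes; no; ¬?; contradiction)
open import Relation.Nullary.Decidable using (decidable-stable; T?; ⌊_⌋)
open import Relation.Binary.Definitions using (DecidableEquality; Symmetric)
open import Relation.Binary.PropositionalEquality
  using (_≡_; _≢_; ≢-sym; refl; sym; trans; cong; subst; subst₂; module ≡-Reasoning)

module _ {A : Set} (_≟ᴬ_ : DecidableEquality A) where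
  open DecMembership _≟ᴬ_ using (_∈?_)

  Unique-⊆⇒length≤ : ∀ {xs ys : List A} → Unique xs → xs ⊆ ys → length xs ≤ length ys
  Unique-⊆⇒length≤ {[]} _ _ = z≤n
  Unique-⊆⇒length≤ {x ∷ xs} {ys} (x∉xs ∷ xs!) xs⊆ys =
    ≤-trans (s≤s (Unique-⊆⇒length≤ xs! xs⊆ys∖x))
            (filter-notAll (λ y → ¬? (y ≟ᴬ x)) ys (Any.map (λ y≡x y≢x → y≢x (sym y≡x)) (xs⊆ys (here refl))))
    where
    xs⊆ys∖x : xs ⊆ filter (λ y → ¬? (y ≟ᴬ x)) ys
    xs⊆ys∖x y∈xs = ∈-filter⁺ (λ y → ¬? (y ≟ᴬ x)) (xs⊆ys (there y∈xs)) (λ y≡x → All.lookup x∉xs y∈xs (sym y≡x))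

  length<⇒∃∉ : ∀ {xs ys : List A} → Unique xs → length ys < length xs → ∃[ x ] x ∈ xs × x ∉ ys
  length<⇒∃∉ {xs} {ys} xs! ys<xs with any? (λ x → ¬? (x ∈? ys)) xs
  ... | yes some = find some
  ... | no none = contradiction (Unique-⊆⇒length≤ xs! xs⊆ys) (<⇒≱ ys<xs)
    where
    xs⊆ys : xs ⊆ ys
    xs⊆ys x∈xs = decidable-stable (_ ∈? ys) (All.lookup (¬Any⇒All¬ xs none) x∈xs)

AllPairs-lookup : {A : Set} {R : A → A → Set} {xs : List A} {x y : A} →
                  Symmetric R → AllPairs R xs → x ∈ xs → y ∈ xs → x ≢ y → R x y
AllPairs-lookup sym-R (_ ∷ _) (here refl) (here refl) x≢y = ⊥-elim (x≢y refl)
AllPairs-lookup sym-R (Rx ∷ _) (here refl) (there y∈) _ = All.lookup Rx y∈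
AllPairs-lookup sym-R (Rx ∷ _) (there x∈) (here refl) _ = sym-R (All.lookup Rx x∈)
AllPairs-lookup sym-R (_ ∷ Rxs) (there x∈) (there y∈) x≢y = AllPairs-lookup sym-R Rxs x∈ y∈ x≢y

AllPairs-mapWithAll : {A : Set} {P : A → Set} {R S : A → A → Set} →
                      (∀ {x y} → P x → P y → R x y → S x y) →
                      ∀ {xs} → All P xs → AllPairs R xs → AllPairs S xs
AllPairs-mapWithAll R⇒S [] [] = []
AllPairs-mapWithAll R⇒S (px ∷ pxs) (Rx ∷ Rxs) =
  All.zipWith (λ (py , r) → R⇒S px py r) (pxs , Rx) ∷ AllPairs-mapWithAll R⇒S pxs Rxs

module _ {A B : Set} (f : A → Maybe B) where

  ∈-mapMaybe⁻ : ∀ {xs y} → y ∈ mapMaybe f xs → ∃[ x ] x ∈ xs × f x ≡ just y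
  ∈-mapMaybe⁻ {x ∷ xs} y∈ with f x in fx≡
  ... | nothing = let z , z∈ , fz≡ = ∈-mapMaybe⁻ y∈ in z , there z∈ , fz≡
  ... | just _ with y∈
  ...   | here refl = x , here refl , fx≡
  ...   | there y∈′ = let z , z∈ , fz≡ = ∈-mapMaybe⁻ y∈′ in z , there z∈ , fz≡

  ∈-mapMaybe⁺ : ∀ {xs x y} → x ∈ xs → f x ≡ just y → y ∈ mapMaybe f xs
  ∈-mapMaybe⁺ {x ∷ xs} (here refl) fx≡ with f x
  ... | just _ with refl ← fx≡ = here refl
  ∈-mapMaybe⁺ {x ∷ xs} (there x∈) fx≡ with f x
  ... | nothing = ∈-mapMaybe⁺ x∈ fx≡
  ... | just _ = there (∈-mapMaybe⁺ x∈ fx≡)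

  mapMaybe-mono : ∀ {xs ys} → xs ⊆ ys → mapMaybe f xs ⊆ mapMaybe f ys
  mapMaybe-mono xs⊆ys y∈ = let x , x∈ , fx≡ = ∈-mapMaybe⁻ y∈ in ∈-mapMaybe⁺ (xs⊆ys x∈) fx≡

  All-mapMaybe⁺ : {P : A → Set} {Q : B → Set} → (∀ {x y} → f x ≡ just y → P x → Q y) →
                  ∀ {xs} → All P xs → All Q (mapMaybe f xs)
  All-mapMaybe⁺ P⇒Q Pxs = All.tabulate λ y∈ → let x , x∈ , fx≡ = ∈-mapMaybe⁻ y∈ in P⇒Q fx≡ (All.lookup Pxs x∈)

  AllPairs-mapMaybe⁺ : {R : A → A → Set} {S : B → B → Set} →
                       (∀ {x x′ y y′} → f x ≡ just y → f x′ ≡ just y′ → R x x′ → S y y′) →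
                       ∀ {xs} → AllPairs R xs → AllPairs S (mapMaybe f xs)
  AllPairs-mapMaybe⁺ R⇒S {[]} [] = []
  AllPairs-mapMaybe⁺ R⇒S {x ∷ xs} (Rx ∷ Rxs) with f x in fx≡
  ... | nothing = AllPairs-mapMaybe⁺ R⇒S Rxs
  ... | just _ = All-mapMaybe⁺ (λ fx′≡ → R⇒S fx≡ fx′≡) Rx ∷ AllPairs-mapMaybe⁺ R⇒S Rxs

  length-mapMaybe-∷ : ∀ {x} xs → f x ≡ nothing → length (mapMaybe f (x ∷ xs)) ≤ length xs
  length-mapMaybe-∷ {x} xs fx≡ with f x
  ... | nothing = length-mapMaybe f xs

module Partner {A C : Set} (_≟ᴬ_ : DecidableEquality A) where

  Disjoint : A × A × C → A × A × C → Set
  Disjoint (u , v , _) (u′ , v′ , _) = u ≢ u′ × u ≢ v′ × v ≢ u′ × v ≢ v′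

  Disjoint-sym : Symmetric Disjoint
  Disjoint-sym (u≢u′ , u≢v′ , v≢u′ , v≢v′) = ≢-sym u≢u′ , ≢-sym v≢u′ , ≢-sym u≢v′ , ≢-sym v≢v′

  Avoids : A → A × A × C → Set
  Avoids w (u , v , _) = w ≢ u × w ≢ v

  Disjoint⇒Avoids : ∀ e e′ → Disjoint e e′ → Avoids (proj₁ e) e′
  Disjoint⇒Avoids _ _ (u≢u′ , u≢v′ , _) = u≢u′ , u≢v′

  partner : List (A × A × C) → A → Maybe A
  partner [] w = nothing
  partner ((u , v , _) ∷ M) w with w ≟ᴬ u | w ≟ᴬ v
  ... | yes _ | _ = just v
  ... | no _ | yes _ = just u
  ... | no _ | no _ = partner M w

  partner-just : ∀ M {w w′} → partner M w ≡ just w′ → ∃[ c ] ((w , w′ , c) ∈ M ⊎ (w′ , w , c) ∈ M)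
  partner-just ((u , v , c) ∷ M) {w} eq with w ≟ᴬ u | w ≟ᴬ v
  partner-just ((u , v , c) ∷ M) refl | yes refl | _ = c , inj₁ (here refl)
  partner-just ((u , v , c) ∷ M) refl | no _ | yes refl = c , inj₂ (here refl)
  partner-just ((u , v , c) ∷ M) eq | no _ | no _ = let c′ , e∈ = partner-just M eq in c′ , Sum.map there there e∈

  partner-nothing : ∀ {M w} → All (Avoids w) M → partner M w ≡ nothing
  partner-nothing {[]} [] = refl
  partner-nothing {(u , v , _) ∷ M} {w} ((w≢u , w≢v) ∷ avoids) with w ≟ᴬ u | w ≟ᴬ v
  ... | yes w≡u | _ = contradiction w≡u w≢u
  ... | no _ | yes w≡v = contradiction w≡v w≢v
  ... | no _ | no _ = partner-nothing avoids

  partner-∈ : ∀ {M u v c} → AllPairs Disjoint M → All (λ { (u , v , _) → u ≢ v }) M →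
              (u , v , c) ∈ M → partner M u ≡ just v × partner M v ≡ just u
  partner-∈ {_ ∷ M} {u} {v} {c} _ (u≢v ∷ _) (here refl) = partner-here , partner-there
    where
    partner-here : partner ((u , v , c) ∷ M) u ≡ just v
    partner-here with u ≟ᴬ u
    ... | yes _ = refl
    ... | no u≢u = contradiction refl u≢u
    partner-there : partner ((u , v , c) ∷ M) v ≡ just u
    partner-there with v ≟ᴬ u | v ≟ᴬ v
    ... | yes v≡u | _ = contradiction (sym v≡u) u≢v
    ... | no _ | yes _ = refl
    ... | no _ | no v≢v = contradiction refl v≢v
  partner-∈ {(u′ , v′ , c′) ∷ M} {u} {v} (disj ∷ disjs) (_ ∷ loopless) (there uv∈) =
    let u≢u′ , u≢v′ , v≢u′ , v≢v′ = All.lookup disj uv∈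
        pu , pv = partner-∈ disjs loopless uv∈
    in trans (skip (u≢u′ ∘ sym) (v≢u′ ∘ sym)) pu , trans (skip (u≢v′ ∘ sym) (v≢v′ ∘ sym)) pv
    where
    skip : ∀ {w} → w ≢ u′ → w ≢ v′ → partner ((u′ , v′ , c′) ∷ M) w ≡ partner M w
    skip {w} w≢u′ w≢v′ with w ≟ᴬ u′ | w ≟ᴬ v′
    ... | yes w≡u′ | _ = contradiction w≡u′ w≢u′
    ... | no _ | yes w≡v′ = contradiction w≡v′ w≢v′
    ... | no _ | no _ = refl

module _ {A : Set} {P : A → Set} {B : Set} {f : ∀ {x} → P x → B} where

  length-reduce : ∀ {xs} (pxs : All P xs) → length (All.reduce f pxs) ≡ length xs
  length-reduce [] = refl
  length-reduce (_ ∷ pxs) = cong suc (length-reduce pxs)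

  Unique-reduce : (∀ {x y} (px : P x) (py : P y) → x ≢ y → f px ≢ f py) →
                  ∀ {xs} → Unique xs → (pxs : All P xs) → Unique (All.reduce f pxs)
  Unique-reduce f-injective [] [] = []
  Unique-reduce f-injective (x∉xs ∷ xs!) (px ∷ pxs) = head x∉xs pxs ∷ Unique-reduce f-injective xs! pxs
    where
    head : ∀ {ys} → All (_ ≢_) ys → (pys : All P ys) → All (f px ≢_) (All.reduce f pys)
    head [] [] = []
    head (x≢y ∷ x≢ys) (py ∷ pys) = f-injective px py x≢y ∷ head x≢ys pys

sum-indicator≡length-filter : {A : Set} (b : A → Bool) (xs : List A) →
  sum (map (λ x → if b x then 1 else 0) xs) ≡ length (filter (T? ∘ b) xs)
sum-indicator≡length-filter b [] = refl
sum-indicator≡length-filter b (x ∷ xs) with b x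
... | true = cong suc (sum-indicator≡length-filter b xs)
... | false = sum-indicator≡length-filter b xs

foldr-⊔-lub : {A : Set} (g : A → ℕ) {m : ℕ} → (∀ x → g x ≤ m) → ∀ xs → foldr _⊔_ 0 (map g xs) ≤ m
foldr-⊔-lub g g≤m [] = z≤n
foldr-⊔-lub g g≤m (x ∷ xs) = ⊔-lub (g≤m x) (foldr-⊔-lub g g≤m xs)

module _ (G : Graph) where

  neighbours : Fin (n G) → List (Fin (n G))
  neighbours u = filter (T? ∘ adj G u) (allFin (n G))

  neighbours-Unique : ∀ u → Unique (neighbours u)
  neighbours-Unique u = Unique-filter⁺ (T? ∘ adj G u) (allFin⁺ (n G))

  deg≡length-neighbours : ∀ u → deg G u ≡ length (neighbours u)
  deg≡length-neighbours u = sum-indicator≡length-filter (adj G u) (allFin (n G))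

  deg≤colours : ∀ {t} → Colorable G t → ∀ u → deg G u ≤ t
  deg≤colours {t} (f , _ , distinct) u = begin
    deg G u                        ≡⟨ deg≡length-neighbours u ⟩
    length (neighbours u)          ≡⟨ length-reduce adjacent ⟨
    length colours                 ≤⟨ Unique-⊆⇒length≤ _≟_ colours-Unique (λ {c} _ → ∈-allFin c) ⟩
    length (allFin t)              ≡⟨ length-tabulate _ ⟩
    t                              ∎
    where
    open ≤-Reasoning
    adjacent : All (Adj G u) (neighbours u)
    adjacent = all-filter (T? ∘ adj G u) (allFin (n G))
    colours : List (Fin t)
    colours = All.reduce (f u _) adjacent
    colours-Unique : Unique colours
    colours-Unique = Unique-reduce (λ p q → distinct u _ _ p q) (neighbours-Unique u) adjacent

  Δ≤colours : ∀ {t} → Colorable G t → Δ G ≤ t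
  Δ≤colours col = foldr-⊔-lub (deg G) (deg≤colours col) (allFin (n G))

  Regular⇒Δ≤deg : Regular G → ∀ u → Δ G ≤ deg G u
  Regular⇒Δ≤deg reg u = foldr-⊔-lub (deg G) (λ v → ≤-reflexive (reg v u)) (allFin (n G))

  fresh-neighbour : Regular G → ∀ u (L : List (Fin (n G))) → length L < Δ G →
                    ∃[ w ] Adj G u w × w ∉ L
  fresh-neighbour reg u L L<Δ =
    let w , w∈ , w∉L = length<⇒∃∉ _≟_ (neighbours-Unique u)
                         (≤-trans L<Δ (≤-trans (Regular⇒Δ≤deg reg u) (≤-reflexive (deg≡length-neighbours u))))
    in w , proj₂ (∈-filter⁻ (T? ∘ adj G u) {xs = allFin (n G)} w∈) , w∉L

Fin2-dichotomy : {x y z : Fin 2} → y ≢ z → x ≡ y ⊎ x ≡ z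
Fin2-dichotomy {zero} {zero} _ = inj₁ refl
Fin2-dichotomy {zero} {suc zero} {zero} _ = inj₂ refl
Fin2-dichotomy {zero} {suc zero} {suc zero} y≢z = contradiction refl y≢z
Fin2-dichotomy {suc zero} {zero} {zero} y≢z = contradiction refl y≢z
Fin2-dichotomy {suc zero} {zero} {suc zero} _ = inj₂ refl
Fin2-dichotomy {suc zero} {suc zero} _ = inj₁ refl

module Product (G : Graph) where

  V : Set
  V = Fin (n G)

  Point : Set
  Point = V × Fin 2

  point : Fin (n (G □K₂)) → Point
  point = remQuot 2

  point-injective : ∀ {i j} → point i ≡ point j → i ≡ j
  point-injective {i} {j} eq = begin
    i                         ≡⟨ combine-remQuot {n G} 2 i ⟨
    uncurry combine (point i) ≡⟨ cong (uncurry combine) eq ⟩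
    uncurry combine (point j) ≡⟨ combine-remQuot {n G} 2 j ⟩
    j                         ∎
    where open ≡-Reasoning

  adjPoints : Point → Point → Bool
  adjPoints (u , x) (v , y) = (⌊ u ≟ v ⌋ ∧ not ⌊ x ≟ y ⌋) ∨ (⌊ x ≟ y ⌋ ∧ adj G u v)

  adj-□K₂ : ∀ i j → adj (G □K₂) i j ≡ adjPoints (point i) (point j)
  adj-□K₂ i j with remQuot {n G} 2 i | remQuot {n G} 2 j
  ... | _ | _ = refl

  data Link : Point → Point → Set where
    layer : ∀ x {u v} → Adj G u v → Link (u , x) (v , x)
    rung  : ∀ u {x y} → x ≢ y → Link (u , x) (u , y)

  link : ∀ a b → T (adjPoints a b) → Link a b
  link (u , x) (v , y) q with x ≟ y
  ... | yes refl = layer x (subst T (cong (_∨ adj G u v) (∧-zeroʳ ⌊ u ≟ v ⌋)) q)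
  ... | no x≢y with u ≟ v
  ...   | yes refl = rung u x≢y
  ...   | no _ = ⊥-elim q

  link-□K₂ : ∀ i j → Adj (G □K₂) i j → Link (point i) (point j)
  link-□K₂ i j p = link (point i) (point j) (subst T (adj-□K₂ i j) p)

module Pieces (G : Graph) (t : ℕ) where
  open Product G
  open Partner {V} {Fin t} _≟_ using (Avoids; Disjoint-sym)

  Edge : Set
  Edge = V × V × Fin t

  data Piece : Set where
    layerEdge : Fin 2 → Edge → Piece
    rung      : V → Fin t → Piece

  pieceAt : Point → Point → Fin t → Piece
  pieceAt (u , x) (v , y) c with x ≟ y
  ... | yes _ = layerEdge x (u , v , c)
  ... | no _ = rung u c

  piece : Fin (n (G □K₂)) × Fin (n (G □K₂)) × Fin t → Piece
  piece (i , j , c) = pieceAt (point i) (point j) c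

  linkPiece : ∀ {a b} → Link a b → Fin t → Piece
  linkPiece (layer x {u} {v} _) c = layerEdge x (u , v , c)
  linkPiece (rung u _) c = rung u c

  pieceAt-link : ∀ {a b} (l : Link a b) c → pieceAt a b c ≡ linkPiece l c
  pieceAt-link (layer x _) c with x ≟ x
  ... | yes _ = refl
  ... | no x≢x = contradiction refl x≢x
  pieceAt-link (rung u {x} {y} x≢y) c with x ≟ y
  ... | yes x≡y = contradiction x≡y x≢y
  ... | no _ = refl

  Placed : Piece → Set
  Placed (layerEdge _ (u , v , _)) = Adj G u v
  Placed (rung _ _) = ⊤

  linkPiece-placed : ∀ {a b} (l : Link a b) c → Placed (linkPiece l c)
  linkPiece-placed (layer _ p) _ = p
  linkPiece-placed (rung _ _) _ = tt

  Apart : Piece → Piece → Set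
  Apart (layerEdge x e) (layerEdge y e′) = x ≡ y → DisjointEdges {G} {t} e e′
  Apart (layerEdge _ e) (rung u _) = Avoids u e
  Apart (rung u _) (layerEdge _ e) = Avoids u e
  Apart (rung u _) (rung u′ _) = u ≢ u′

  Apart-sym : Symmetric Apart
  Apart-sym {layerEdge _ e} {layerEdge _ e′} apart refl = Disjoint-sym {e} {e′} (apart refl)
  Apart-sym {layerEdge _ _} {rung _ _} apart = apart
  Apart-sym {rung _ _} {layerEdge _ _} apart = apart
  Apart-sym {rung _ _} {rung _ _} apart = ≢-sym apart

  rung-avoids : ∀ {u w : V} {x y z : Fin 2} → x ≢ y →
                _≢_ {A = Point} (u , x) (w , z) → _≢_ {A = Point} (u , y) (w , z) → u ≢ w
  rung-avoids {z = z} x≢y ux≢wz uy≢wz refl with Fin2-dichotomy {z} x≢y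
  ... | inj₁ refl = ux≢wz refl
  ... | inj₂ refl = uy≢wz refl

  linkPiece-apart : ∀ {a b a′ b′} (l : Link a b) (l′ : Link a′ b′) c c′ →
                    a ≢ a′ → a ≢ b′ → b ≢ a′ → b ≢ b′ → Apart (linkPiece l c) (linkPiece l′ c′)
  linkPiece-apart (layer x _) (layer .x _) _ _ a≢a′ a≢b′ b≢a′ b≢b′ refl =
    a≢a′ ∘ cong (_, x) , a≢b′ ∘ cong (_, x) , b≢a′ ∘ cong (_, x) , b≢b′ ∘ cong (_, x)
  linkPiece-apart (layer _ _) (rung _ y≢y′) _ _ a≢a′ a≢b′ b≢a′ b≢b′ =
    rung-avoids y≢y′ (≢-sym a≢a′) (≢-sym a≢b′) , rung-avoids y≢y′ (≢-sym b≢a′) (≢-sym b≢b′)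
  linkPiece-apart (rung _ x≢y) (layer _ _) _ _ a≢a′ a≢b′ b≢a′ b≢b′ =
    rung-avoids x≢y a≢a′ b≢a′ , rung-avoids x≢y a≢b′ b≢b′
  linkPiece-apart (rung _ x≢y) (rung _ _) _ _ a≢a′ _ b≢a′ _ = rung-avoids x≢y a≢a′ b≢a′

  layerEdge? : Fin 2 → Piece → Maybe Edge
  layerEdge? x (layerEdge y e) with x ≟ y
  ... | yes _ = just e
  ... | no _ = nothing
  layerEdge? _ (rung _ _) = nothing

  layerEdge?-self : ∀ x e → layerEdge? x (layerEdge x e) ≡ just e
  layerEdge?-self x e with x ≟ x
  ... | yes _ = refl
  ... | no x≢x = contradiction refl x≢x

  layerEdge?-just : ∀ {x p e} → layerEdge? x p ≡ just e → p ≡ layerEdge x e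
  layerEdge?-just {x} {layerEdge y e} eq with x ≟ y
  layerEdge?-just {x} {layerEdge .x e} refl | yes refl = refl

  rung? : Piece → Maybe (V × Fin t)
  rung? (rung u c) = just (u , c)
  rung? (layerEdge _ _) = nothing

  rung?-just : ∀ {p u c} → rung? p ≡ just (u , c) → p ≡ rung u c
  rung?-just {rung u c} refl = refl

  record Layout : Set where
    field
      layerEdges : Fin 2 → Precoloring G t
      rungs : List (V × Fin t)
      layer-independent : ∀ x → IndependentPrecoloring G (layerEdges x)
      rungs-distinct : AllPairs (λ r r′ → proj₁ r ≢ proj₁ r′) rungs
      rungs-avoid : ∀ {r e} → r ∈ rungs → e ∈ layerEdges zero ++ layerEdges (suc zero) → Avoids (proj₁ r) e

  size : Layout → ℕ
  size L = length (layerEdges zero) + length (layerEdges (suc zero)) + length rungs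
    where open Layout L

  pieces-size : ∀ ps → length (mapMaybe (layerEdge? zero) ps) + length (mapMaybe (layerEdge? (suc zero)) ps)
                       + length (mapMaybe rung? ps) ≡ length ps
  pieces-size [] = refl
  pieces-size (layerEdge zero _ ∷ ps) = cong suc (pieces-size ps)
  pieces-size (layerEdge (suc zero) _ ∷ ps) =
    trans (cong (_+ length (mapMaybe rung? ps)) (+-suc (length (mapMaybe (layerEdge? zero) ps)) _))
          (cong suc (pieces-size ps))
  pieces-size (rung _ _ ∷ ps) = trans (+-suc _ _) (cong suc (pieces-size ps))

  module _ (P : Precoloring (G □K₂) t) (P-independent : IndependentPrecoloring (G □K₂) P) where

    pieces : List Piece
    pieces = map piece P

    pieces-placed : All Placed pieces
    pieces-placed = Allₚ.map⁺ (All.tabulate placed)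
      where
      placed : ∀ {e} → e ∈ P → Placed (piece e)
      placed {i , j , c} e∈ = let l = link-□K₂ i j (All.lookup (proj₁ P-independent) e∈) in
        subst Placed (sym (pieceAt-link l c)) (linkPiece-placed l c)

    pieces-apart : AllPairs Apart pieces
    pieces-apart = AllPairsₚ.map⁺ (AllPairs-mapWithAll apart (proj₁ P-independent) (proj₂ P-independent))
      where
      apart : ∀ {e e′} → Adj (G □K₂) (proj₁ e) (proj₁ (proj₂ e)) → Adj (G □K₂) (proj₁ e′) (proj₁ (proj₂ e′)) →
              DisjointEdges {G □K₂} {t} e e′ → Apart (piece e) (piece e′)
      apart {i , j , c} {i′ , j′ , c′} p p′ (i≢i′ , i≢j′ , j≢i′ , j≢j′) =
        subst₂ Apart (sym (pieceAt-link l c)) (sym (pieceAt-link l′ c′))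
          (linkPiece-apart l l′ c c′ (i≢i′ ∘ point-injective) (i≢j′ ∘ point-injective)
                                     (j≢i′ ∘ point-injective) (j≢j′ ∘ point-injective))
        where
        l = link-□K₂ i j p
        l′ = link-□K₂ i′ j′ p′

    layout : Layout
    layout = record
      { layerEdges = λ x → mapMaybe (layerEdge? x) pieces
      ; rungs = mapMaybe rung? pieces
      ; layer-independent = λ x →
          All-mapMaybe⁺ (layerEdge? x) (λ {p} eq → subst Placed (layerEdge?-just {x} {p} eq)) pieces-placed ,
          AllPairs-mapMaybe⁺ (layerEdge? x)
            (λ {p} {p′} eq eq′ apart →
               subst₂ Apart (layerEdge?-just {x} {p} eq) (layerEdge?-just {x} {p′} eq′) apart refl)
            pieces-apart
      ; rungs-distinct = AllPairs-mapMaybe⁺ rung?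
          (λ {p} {p′} eq eq′ → subst₂ Apart (rung?-just {p} eq) (rung?-just {p′} eq′)) pieces-apart
      ; rungs-avoid = rungs-avoid
      }
      where
      rung-avoids-layer : ∀ {u c e} → rung u c ∈ pieces → ∀ x → e ∈ mapMaybe (layerEdge? x) pieces → Avoids u e
      rung-avoids-layer p∈ x e∈ with ∈-mapMaybe⁻ (layerEdge? x) e∈
      ... | p′ , p′∈ , eq with refl ← layerEdge?-just {x} {p′} eq = AllPairs-lookup Apart-sym pieces-apart p∈ p′∈ λ ()

      rungs-avoid : ∀ {r e} → r ∈ mapMaybe rung? pieces →
                    e ∈ mapMaybe (layerEdge? zero) pieces ++ mapMaybe (layerEdge? (suc zero)) pieces →
                    Avoids (proj₁ r) e
      rungs-avoid r∈ e∈ with ∈-mapMaybe⁻ rung? r∈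
      ... | p , p∈ , eq with refl ← rung?-just {p} eq with ∈-++⁻ (mapMaybe (layerEdge? zero) pieces) e∈
      ...   | inj₁ e∈₀ = rung-avoids-layer p∈ zero e∈₀
      ...   | inj₂ e∈₁ = rung-avoids-layer p∈ (suc zero) e∈₁

    layout-size : size layout ≡ length P
    layout-size = trans (pieces-size pieces) (length-map piece P)

module Lifting (G : Graph) (simple : IsSimple G) (χ : ℕ) where
  open Product G
  open Pieces G (suc χ)
  open Partner {V} {Fin (suc χ)} _≟_

  adjacent⇒distinct : ∀ {u v} → Adj G u v → u ≢ v
  adjacent⇒distinct {u} p refl = proj₂ simple u p

  AgreeOn : EdgeColoring G χ → EdgeColoring G χ → V × V × Fin (suc χ) → Set
  AgreeOn f g (u , v , _) = (p : Adj G u v) → f u v p ≡ g u v p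

  record LiftData : Set where
    field
      colouring : Fin 2 → EdgeColoring G χ
      proper : ∀ x → IsProper G (colouring x)
      matching : Precoloring G (suc χ)
      matching-independent : IndependentPrecoloring G matching
      agree : All (AgreeOn (colouring zero) (colouring (suc zero))) matching
      spare : Fin (suc χ)

  module Lift (D : LiftData) where
    open LiftData D

    mate : V → Maybe V
    mate = partner matching

    mate-∈ : ∀ {u v} → mate u ≡ just v → ∃[ c ] ((u , v , c) ∈ matching ⊎ (v , u , c) ∈ matching)
    mate-∈ = partner-just matching

    mate-of-∈ : ∀ {u v c} → (u , v , c) ∈ matching → mate u ≡ just v × mate v ≡ just u
    mate-of-∈ = partner-∈ (proj₂ matching-independent) (All.map adjacent⇒distinct (proj₁ matching-independent))

    mate-adj : ∀ {u v} → mate u ≡ just v → Adj G u v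
    mate-adj eq with mate-∈ eq
    ... | _ , inj₁ e∈ = All.lookup (proj₁ matching-independent) e∈
    ... | _ , inj₂ e∈ = proj₁ simple _ _ (All.lookup (proj₁ matching-independent) e∈)

    mate-sym : ∀ {u v} → mate u ≡ just v → mate v ≡ just u
    mate-sym eq with mate-∈ eq
    ... | _ , inj₁ e∈ = proj₂ (mate-of-∈ e∈)
    ... | _ , inj₂ e∈ = proj₁ (mate-of-∈ e∈)

    mate-agree : ∀ {u v} → mate u ≡ just v → ∀ x (p : Adj G u v) → colouring zero u v p ≡ colouring x u v p
    mate-agree eq zero p = refl
    mate-agree {u} {v} eq (suc zero) p with mate-∈ eq
    ... | _ , inj₁ e∈ = All.lookup agree e∈ p
    ... | _ , inj₂ e∈ = begin
      colouring zero u v p          ≡⟨ proj₁ (proper zero) u v p q ⟩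
      colouring zero v u q          ≡⟨ All.lookup agree e∈ q ⟩
      colouring (suc zero) v u q    ≡⟨ proj₁ (proper (suc zero)) v u q p ⟩
      colouring (suc zero) u v p    ∎
      where
      open ≡-Reasoning
      q = proj₁ simple u v p

    matched? : ∀ u v → Dec (mate u ≡ just v)
    matched? u v = ≡-dec _≟_ (mate u) (just v)

    layerColour : Fin 2 → EdgeColoring G (suc χ)
    layerColour x u v p with matched? u v
    ... | yes _ = spare
    ... | no _ = punchIn spare (colouring x u v p)

    rungColourAt : ∀ u m → mate u ≡ m → Fin (suc χ)
    rungColourAt u nothing _ = spare
    rungColourAt u (just w) eq = punchIn spare (colouring zero u w (mate-adj eq))

    rungColour : V → Fin (suc χ)
    rungColour u = rungColourAt u (mate u) refl

    layerColour-sym : ∀ x u v p q → layerColour x u v p ≡ layerColour x v u q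
    layerColour-sym x u v p q with matched? u v | matched? v u
    ... | yes _ | yes _ = refl
    ... | yes uv | no ¬vu = contradiction (mate-sym uv) ¬vu
    ... | no ¬uv | yes vu = contradiction (mate-sym vu) ¬uv
    ... | no _ | no _ = cong (punchIn spare) (proj₁ (proper x) u v p q)

    layerColour-distinct : ∀ x u v w p q → v ≢ w → layerColour x u v p ≢ layerColour x u w q
    layerColour-distinct x u v w p q v≢w with matched? u v | matched? u w
    ... | yes uv | yes uw = λ _ → v≢w (just-injective (trans (sym uv) uw))
    ... | yes _ | no _ = punchInᵢ≢i spare _ ∘ sym
    ... | no _ | yes _ = punchInᵢ≢i spare _
    ... | no _ | no _ = proj₂ (proper x) u v w p q v≢w ∘ punchIn-injective spare _ _

    layerColour≢rungColour : ∀ x u v p → layerColour x u v p ≢ rungColour u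
    layerColour≢rungColour x u v p = differs (mate u) refl
      where
      differs : ∀ m (eq : mate u ≡ m) → layerColour x u v p ≢ rungColourAt u m eq
      differs m eq with matched? u v
      differs nothing eq | yes uv with () ← trans (sym eq) uv
      differs nothing eq | no _ = punchInᵢ≢i spare _
      differs (just w) eq | yes _ = punchInᵢ≢i spare _ ∘ sym
      differs (just w) eq | no ¬uv = λ same →
        proj₂ (proper x) u v w p r (λ { refl → ¬uv eq })
          (trans (punchIn-injective spare _ _ same) (mate-agree eq x r))
        where r = mate-adj eq

    linkColour : ∀ {a b} → Link a b → Fin (suc χ)
    linkColour (layer x p) = layerColour x _ _ p
    linkColour (rung u _) = rungColour u

    linkColour-sym : ∀ {a b} (l : Link a b) (l′ : Link b a) → linkColour l ≡ linkColour l′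
    linkColour-sym (layer x p) (layer .x q) = layerColour-sym x _ _ p q
    linkColour-sym (layer x p) (rung _ x≢x) = contradiction refl x≢x
    linkColour-sym (rung u x≢x) (layer _ _) = contradiction refl x≢x
    linkColour-sym (rung u _) (rung .u _) = refl

    linkColour-distinct : ∀ {a b c} (l : Link a b) (l′ : Link a c) → b ≢ c → linkColour l ≢ linkColour l′
    linkColour-distinct (layer x p) (layer .x q) b≢c = layerColour-distinct x _ _ _ p q (b≢c ∘ cong (_, x))
    linkColour-distinct (layer x p) (rung _ _) _ = layerColour≢rungColour x _ _ p
    linkColour-distinct (rung _ _) (layer x q) _ = layerColour≢rungColour x _ _ q ∘ sym
    linkColour-distinct (rung u x≢y) (rung .u x≢z) b≢c with Fin2-dichotomy x≢y
    ... | inj₁ z≡x = contradiction (sym z≡x) x≢z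
    ... | inj₂ refl = contradiction refl b≢c

    lifted : EdgeColoring (G □K₂) (suc χ)
    lifted i j p = linkColour (link-□K₂ i j p)

    lifted-proper : IsProper (G □K₂) lifted
    lifted-proper = (λ i j p q → linkColour-sym (link-□K₂ i j p) (link-□K₂ j i q))
                  , (λ i j l p q j≢l → linkColour-distinct (link-□K₂ i j p) (link-□K₂ i l q) (j≢l ∘ point-injective))

    layerColour-matched : ∀ {u v c} → (u , v , c) ∈ matching → ∀ x p → layerColour x u v p ≡ spare
    layerColour-matched {u} {v} e∈ x p with matched? u v
    ... | yes _ = refl
    ... | no ¬uv = contradiction (proj₁ (mate-of-∈ e∈)) ¬uv

    layerColour-unmatched : ∀ {u} → All (Avoids u) matching → ∀ x v p →
                            layerColour x u v p ≡ punchIn spare (colouring x u v p)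
    layerColour-unmatched {u} avoids x v p with matched? u v
    ... | yes uv with () ← trans (sym (partner-nothing avoids)) uv
    ... | no _ = refl

    rungColour-matched : ∀ {u w c} → (u , w , c) ∈ matching → (p : Adj G u w) →
                         rungColour u ≡ punchIn spare (colouring zero u w p)
    rungColour-matched {u} {w} e∈ p = at (mate u) refl (proj₁ (mate-of-∈ e∈))
      where
      at : ∀ m (eq : mate u ≡ m) → m ≡ just w → rungColourAt u m eq ≡ punchIn spare (colouring zero u w p)
      at (just .w) eq refl = cong (punchIn spare ∘ colouring zero u w) (T-irrelevant _ _)

    rungColour-unmatched : ∀ {u} → All (Avoids u) matching → rungColour u ≡ spare
    rungColour-unmatched {u} avoids = at (mate u) refl (partner-nothing avoids)
      where
      at : ∀ m (eq : mate u ≡ m) → m ≡ nothing → rungColourAt u m eq ≡ spare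
      at nothing eq refl = refl

    Satisfied : Piece → Set
    Satisfied (layerEdge x (u , v , c)) = ∀ p → layerColour x u v p ≡ c
    Satisfied (rung u c) = rungColour u ≡ c

    Solves : Layout → Set
    Solves L = (∀ x → All (Satisfied ∘ layerEdge x) (layerEdges x)) × All (λ (u , c) → Satisfied (rung u c)) rungs
      where open Layout L

    linkColour-satisfied : ∀ {a b} (l : Link a b) {c} → Satisfied (linkPiece l c) → linkColour l ≡ c
    linkColour-satisfied (layer _ p) satisfied = satisfied p
    linkColour-satisfied (rung _ _) satisfied = satisfied

    lifted-extends : ∀ P P-independent → Solves (layout P P-independent) → Extendable (G □K₂) (suc χ) P
    lifted-extends P P-independent (layers-solved , rungs-solved) = lifted , lifted-proper , All.tabulate extends
      where
      satisfied : ∀ {p} → p ∈ pieces P P-independent → Satisfied p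
      satisfied {layerEdge x e} p∈ = All.lookup (layers-solved x) (∈-mapMaybe⁺ (layerEdge? x) p∈ (layerEdge?-self x e))
      satisfied {rung u c} p∈ = All.lookup rungs-solved (∈-mapMaybe⁺ rung? p∈ refl)

      extends : ∀ {e} → e ∈ P → (p : Adj (G □K₂) (proj₁ e) (proj₁ (proj₂ e))) → lifted _ _ p ≡ proj₂ (proj₂ e)
      extends {i , j , c} e∈ p =
        linkColour-satisfied l (subst Satisfied (pieceAt-link l c) (satisfied (∈-map⁺ piece e∈)))
        where l = link-□K₂ i j p

module Core (G : Graph) (simple : IsSimple G) (reg : Regular G) (k χ : ℕ) (2k<Δ : 2 * k < Δ G)
            (χ-colours : Colorable G χ)
            (extend : (P : Precoloring G χ) → IndependentPrecoloring G P → length P ≤ k → Extendable G χ P) where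
  open Product G
  open Pieces G (suc χ)
  open Lifting G simple χ
  open Partner {V} {Fin (suc χ)} _≟_ using (Avoids; Disjoint-sym; Disjoint⇒Avoids)

  colour : Edge → Fin (suc χ)
  colour = proj₂ ∘ proj₂

  Coloured : Fin (suc χ) → Edge → Set
  Coloured s e = colour e ≡ s

  coloured? : ∀ s e → Dec (Coloured s e)
  coloured? s e = colour e ≟ s

  endpoints : List Edge → List V
  endpoints [] = []
  endpoints ((u , v , _) ∷ es) = u ∷ v ∷ endpoints es

  endpoints-∈ : ∀ {u v c es} → (u , v , c) ∈ es → u ∈ endpoints es × v ∈ endpoints es
  endpoints-∈ {es = _ ∷ _} (here refl) = here refl , there (here refl)
  endpoints-∈ {es = _ ∷ _} (there e∈) =
    let u∈ , v∈ = endpoints-∈ e∈ in there (there u∈) , there (there v∈)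

  length-endpoints : ∀ es → length (endpoints es) ≡ length es + length es
  length-endpoints [] = refl
  length-endpoints (_ ∷ es) = cong suc (trans (cong suc (length-endpoints es)) (sym (+-suc (length es) (length es))))

  rungOf : Edge → V × Fin (suc χ)
  rungOf (u , _ , c) = u , c

  record Witnesses (pre : List V) (rs : List (V × Fin (suc χ))) : Set where
    field
      edges : List Edge
      edges-rungs : map rungOf edges ≡ rs
      edges-independent : IndependentPrecoloring G edges
      edges-fresh : All (λ (_ , w , _) → w ∉ pre) edges

  +-suc-suc : ∀ a m → a + suc m + suc m ≡ suc (suc (a + m + m))
  +-suc-suc = solve-∀

  -- The bound counts each pending rung twice: once handled, both its endpoints join pre.
  witnesses : ∀ pre rs → AllPairs (λ r r′ → proj₁ r ≢ proj₁ r′) rs →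
              length pre + length rs + length rs ≤ suc (Δ G) → Witnesses pre rs
  witnesses pre [] [] _ = record { edges = [] ; edges-rungs = refl ; edges-independent = [] , [] ; edges-fresh = [] }
  witnesses pre ((u , c) ∷ rs) (u∉rs ∷ rs-distinct) bound = record
    { edges = (u , w , c) ∷ edges
    ; edges-rungs = cong ((u , c) ∷_) edges-rungs
    ; edges-independent = uw ∷ proj₁ edges-independent , All.tabulate head-disjoint ∷ proj₂ edges-independent
    ; edges-fresh = w∉pre++rs ∘ ∈-++⁺ˡ ∷ All.map (_∘ there ∘ there) edges-fresh
    }
    where
    shifted-bound : suc (suc (length pre + length rs + length rs)) ≤ suc (Δ G)
    shifted-bound = subst (_≤ suc (Δ G)) (+-suc-suc (length pre) (length rs)) bound

    fresh-bound : length (pre ++ map proj₁ rs) < Δ G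
    fresh-bound = begin-strict
      length (pre ++ map proj₁ rs)      ≡⟨ length-++ pre ⟩
      length pre + length (map proj₁ rs) ≡⟨ cong (length pre +_) (length-map proj₁ rs) ⟩
      length pre + length rs            ≤⟨ m≤m+n _ (length rs) ⟩
      length pre + length rs + length rs <⟨ ≤-pred shifted-bound ⟩
      Δ G                               ∎
      where open ≤-Reasoning

    fresh = fresh-neighbour G reg u (pre ++ map proj₁ rs) fresh-bound
    w = proj₁ fresh
    uw = proj₁ (proj₂ fresh)
    w∉pre++rs = proj₂ (proj₂ fresh)

    open Witnesses (witnesses (u ∷ w ∷ pre) rs rs-distinct shifted-bound)

    head-disjoint : ∀ {e} → e ∈ edges → DisjointEdges {G} {suc χ} (u , w , c) e
    head-disjoint {u′ , w′ , c′} e∈ =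
      (λ u≡u′ → All.lookup u∉rs r∈ u≡u′) ,
      (λ u≡w′ → All.lookup edges-fresh e∈ (here (sym u≡w′))) ,
      (λ w≡u′ → w∉pre++rs (∈-++⁺ʳ pre (subst (_∈ map proj₁ rs) (sym w≡u′) (∈-map⁺ proj₁ r∈)))) ,
      (λ w≡w′ → All.lookup edges-fresh e∈ (there (here (sym w≡w′))))
      where
      r∈ : (u′ , c′) ∈ rs
      r∈ = subst ((u′ , c′) ∈_) edges-rungs (∈-map⁺ rungOf e∈)

  punch : Fin (suc χ) → Edge → Maybe (V × V × Fin χ)
  punch s (u , v , c) with s ≟ c
  ... | yes _ = nothing
  ... | no s≢c = just (u , v , punchOut s≢c)

  punch-colour : ∀ e → punch (colour e) e ≡ nothing
  punch-colour (u , v , c) with c ≟ c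
  ... | yes _ = refl
  ... | no c≢c = contradiction refl c≢c

  punch-just : ∀ {s u v c q} → punch s (u , v , c) ≡ just q → ∃[ d ] q ≡ (u , v , d)
  punch-just {s} {c = c} eq with s ≟ c
  punch-just refl | no s≢c = punchOut s≢c , refl

  punch-≢ : ∀ {s} u v c → s ≢ c → ∃[ d ] punch s (u , v , c) ≡ just (u , v , d) × punchIn s d ≡ c
  punch-≢ {s} u v c s≢c with s ≟ c
  ... | yes s≡c = contradiction s≡c s≢c
  ... | no s≢c = punchOut s≢c , refl , punchIn-punchOut s≢c

  punch-independent : ∀ s {es} → IndependentPrecoloring G es → IndependentPrecoloring G (mapMaybe (punch s) es)
  punch-independent s (adjacent , disjoint) =
    All-mapMaybe⁺ (punch s) (λ {e} eq → keeps-endpoints {e} eq) adjacent ,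
    AllPairs-mapMaybe⁺ (punch s) (λ {e} {e′} eq eq′ → keeps-disjoint {e} {e′} eq eq′) disjoint
    where
    keeps-endpoints : ∀ {e q} → punch s e ≡ just q →
                      Adj G (proj₁ e) (proj₁ (proj₂ e)) → Adj G (proj₁ q) (proj₁ (proj₂ q))
    keeps-endpoints eq p with _ , refl ← punch-just eq = p
    keeps-disjoint : ∀ {e e′ q q′} → punch s e ≡ just q → punch s e′ ≡ just q′ →
                     DisjointEdges {G} {suc χ} e e′ → DisjointEdges {G} {χ} q q′
    keeps-disjoint eq eq′ d with _ , refl ← punch-just eq | _ , refl ← punch-just eq′ = d

  spare-colour : ∀ es → length es ≤ suc k → ∃[ s ] length (mapMaybe (punch s) es) ≤ k
  spare-colour [] _ = zero , z≤n
  spare-colour (e ∷ es) (s≤s es≤k) = colour e , ≤-trans (length-mapMaybe-∷ (punch (colour e)) es (punch-colour e)) es≤k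

  Extends : EdgeColoring G χ → V × V × Fin χ → Set
  Extends f (u , v , d) = (p : Adj G u v) → f u v p ≡ d

  module Finish (L : Layout) where
    open Layout L

    allLayerEdges : List Edge
    allLayerEdges = layerEdges zero ++ layerEdges (suc zero)

    layer⊆allLayerEdges : ∀ x → layerEdges x ⊆ allLayerEdges
    layer⊆allLayerEdges zero = ∈-++⁺ˡ
    layer⊆allLayerEdges (suc zero) = ∈-++⁺ʳ (layerEdges zero)

    allLayerEdges-adjacent : All (λ (u , v , _) → Adj G u v) allLayerEdges
    allLayerEdges-adjacent = Allₚ.++⁺ (proj₁ (layer-independent zero)) (proj₁ (layer-independent (suc zero)))

    module _ (W : Witnesses (endpoints allLayerEdges) rungs) where
      open Witnesses W

      rung-∈ : ∀ {u w c} → (u , w , c) ∈ edges → (u , c) ∈ rungs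
      rung-∈ {u} {w} {c} e∈ = subst ((u , c) ∈_) edges-rungs (∈-map⁺ rungOf e∈)

      length-edges : length edges ≡ length rungs
      length-edges = trans (sym (length-map rungOf edges)) (cong length edges-rungs)

      layer-witness-disjoint : ∀ {e e′} → e ∈ allLayerEdges → e′ ∈ edges → DisjointEdges {G} {suc χ} e e′
      layer-witness-disjoint {a , b , c} {u , w , c′} e∈ e′∈ =
        ≢-sym (proj₁ u-avoids) , (λ a≡w → w-fresh (subst (_∈ endpoints allLayerEdges) a≡w a∈)) ,
        ≢-sym (proj₂ u-avoids) , (λ b≡w → w-fresh (subst (_∈ endpoints allLayerEdges) b≡w b∈))
        where
        u-avoids = rungs-avoid (rung-∈ e′∈) e∈
        w-fresh = All.lookup edges-fresh e′∈
        a∈ = proj₁ (endpoints-∈ e∈)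
        b∈ = proj₂ (endpoints-∈ e∈)

      with-witnesses-independent : ∀ {es} → es ⊆ allLayerEdges → IndependentPrecoloring G es →
                                   IndependentPrecoloring G (es ++ edges)
      with-witnesses-independent es⊆ (adjacent , disjoint) =
        Allₚ.++⁺ adjacent (proj₁ edges-independent) ,
        AllPairsₚ.++⁺ disjoint (proj₂ edges-independent)
          (All.tabulate λ e∈ → All.tabulate λ e′∈ → layer-witness-disjoint (es⊆ e∈) e′∈)

      module _ (s : Fin (suc χ)) where

        reduced : Fin 2 → Precoloring G χ
        reduced x = mapMaybe (punch s) (layerEdges x ++ edges)

        reduced-independent : ∀ x → IndependentPrecoloring G (reduced x)
        reduced-independent x =
          punch-independent s (with-witnesses-independent (layer⊆allLayerEdges x) (layer-independent x))

        length-reduced : ∀ x → length (reduced x) ≤ length (layerEdges x) + length rungs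
        length-reduced x = begin
          length (reduced x)                     ≤⟨ length-mapMaybe (punch s) (layerEdges x ++ edges) ⟩
          length (layerEdges x ++ edges)         ≡⟨ length-++ (layerEdges x) ⟩
          length (layerEdges x) + length edges   ≡⟨ cong (length (layerEdges x) +_) length-edges ⟩
          length (layerEdges x) + length rungs   ∎
          where open ≤-Reasoning

        spareLayerEdges : List Edge
        spareLayerEdges = filter (coloured? s) allLayerEdges

        otherWitnessEdges : List Edge
        otherWitnessEdges = filter (¬? ∘ coloured? s) edges

        ∈-spareLayerEdges⁻ : ∀ {e} → e ∈ spareLayerEdges → e ∈ allLayerEdges × Coloured s e
        ∈-spareLayerEdges⁻ = ∈-filter⁻ (coloured? s) {xs = allLayerEdges}

        ∈-otherWitnessEdges⁻ : ∀ {e} → e ∈ otherWitnessEdges → e ∈ edges × ¬ Coloured s e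
        ∈-otherWitnessEdges⁻ = ∈-filter⁻ (¬? ∘ coloured? s) {xs = edges}

        matching : Precoloring G (suc χ)
        matching = spareLayerEdges ++ otherWitnessEdges

        module _ (colouring : Fin 2 → EdgeColoring G χ) (proper : ∀ x → IsProper G (colouring x))
                 (extends : ∀ x → All (Extends (colouring x)) (reduced x))
                 (separated : spareLayerEdges ≡ [] ⊎ AllPairs (DisjointEdges {G} {suc χ}) allLayerEdges)
                 (agree-on-spare : All (AgreeOn (colouring zero) (colouring (suc zero))) spareLayerEdges)
                 where

          spareLayerEdges-disjoint : AllPairs (DisjointEdges {G} {suc χ}) spareLayerEdges
          spareLayerEdges-disjoint =
            [ (λ none → subst (AllPairs _) (sym none) []) , AllPairsₚ.filter⁺ (coloured? s) ]′ separated

          matching-independent : IndependentPrecoloring G matching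
          matching-independent =
            Allₚ.++⁺ (Allₚ.filter⁺ (coloured? s) allLayerEdges-adjacent)
                     (Allₚ.filter⁺ (¬? ∘ coloured? s) (proj₁ edges-independent)) ,
            AllPairsₚ.++⁺ spareLayerEdges-disjoint (AllPairsₚ.filter⁺ (¬? ∘ coloured? s) (proj₂ edges-independent))
              (All.tabulate λ e∈ → All.tabulate λ e′∈ →
                layer-witness-disjoint (proj₁ (∈-spareLayerEdges⁻ e∈)) (proj₁ (∈-otherWitnessEdges⁻ e′∈)))

          witness-agree : ∀ {e} → e ∈ otherWitnessEdges → AgreeOn (colouring zero) (colouring (suc zero)) e
          witness-agree {u , w , c} e∈ p =
            trans (All.lookup (extends zero) (reduced∋ zero) p)
                  (sym (All.lookup (extends (suc zero)) (reduced∋ (suc zero)) p))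
            where
            punched = punch-≢ u w c (proj₂ (∈-otherWitnessEdges⁻ e∈) ∘ sym)
            reduced∋ : ∀ x → (u , w , proj₁ punched) ∈ reduced x
            reduced∋ x =
              ∈-mapMaybe⁺ (punch s) (∈-++⁺ʳ (layerEdges x) (proj₁ (∈-otherWitnessEdges⁻ e∈))) (proj₁ (proj₂ punched))

          liftData : LiftData
          liftData = record
            { colouring = colouring
            ; proper = proper
            ; matching = matching
            ; matching-independent = matching-independent
            ; agree = Allₚ.++⁺ agree-on-spare (All.tabulate witness-agree)
            ; spare = s
            }

          open Lift liftData

          layer-endpoint-unmatched : ∀ {a b c} → (a , b , c) ∈ allLayerEdges → ¬ Coloured s (a , b , c) →
                                     All (Avoids a) matching
          layer-endpoint-unmatched {a} {b} {c} e∈ c≢s = All.tabulate avoids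
            where
            avoids : ∀ {e′} → e′ ∈ matching → Avoids a e′
            avoids {e′} e′∈ with ∈-++⁻ spareLayerEdges e′∈
            ... | inj₂ e′∈W =
              Disjoint⇒Avoids (a , b , c) e′ (layer-witness-disjoint e∈ (proj₁ (∈-otherWitnessEdges⁻ e′∈W)))
            ... | inj₁ e′∈S = [ (λ none → contradiction (subst (e′ ∈_) none e′∈S) λ ()) , avoids-spare ]′ separated
              where
              avoids-spare : AllPairs (DisjointEdges {G} {suc χ}) allLayerEdges → Avoids a e′
              avoids-spare disjoint =
                let e′∈L , c′≡s = ∈-spareLayerEdges⁻ e′∈S
                in Disjoint⇒Avoids (a , b , c) e′
                     (AllPairs-lookup (λ {e} {e′} → Disjoint-sym {e} {e′}) disjoint e∈ e′∈L (λ { refl → c≢s c′≡s }))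

          rung-unmatched : ∀ {u w c} → (u , w , c) ∈ edges → Coloured s (u , w , c) → All (Avoids u) matching
          rung-unmatched {u} {w} {c} e∈ c≡s = All.tabulate avoids
            where
            avoids : ∀ {e′} → e′ ∈ matching → Avoids u e′
            avoids {e′} e′∈ with ∈-++⁻ spareLayerEdges e′∈
            ... | inj₁ e′∈S = rungs-avoid (rung-∈ e∈) (proj₁ (∈-spareLayerEdges⁻ e′∈S))
            ... | inj₂ e′∈W =
              let e′∈E , c′≢s = ∈-otherWitnessEdges⁻ e′∈W
              in Disjoint⇒Avoids (u , w , c) e′
                   (AllPairs-lookup (λ {e} {e′} → Disjoint-sym {e} {e′}) (proj₂ edges-independent) e∈ e′∈E
                                    (λ { refl → c′≢s c≡s }))

          layer-solved : ∀ x {e} → e ∈ layerEdges x → Satisfied (layerEdge x e)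
          layer-solved x {a , b , c} e∈ p with coloured? s (a , b , c)
          ... | yes c≡s = trans (layerColour-matched (∈-++⁺ˡ (∈-filter⁺ (coloured? s) e∈L c≡s)) x p) (sym c≡s)
            where e∈L = layer⊆allLayerEdges x e∈
          ... | no c≢s = begin
            layerColour x a b p             ≡⟨ layerColour-unmatched (layer-endpoint-unmatched e∈L c≢s) x b p ⟩
            punchIn s (colouring x a b p)   ≡⟨ cong (punchIn s) (All.lookup (extends x) reduced∋ p) ⟩
            punchIn s d                     ≡⟨ punchIn≡c ⟩
            c                               ∎
            where
            open ≡-Reasoning
            e∈L = layer⊆allLayerEdges x e∈
            punched = punch-≢ a b c (c≢s ∘ sym)
            d = proj₁ punched
            punchIn≡c = proj₂ (proj₂ punched)
            reduced∋ = ∈-mapMaybe⁺ (punch s) (∈-++⁺ˡ e∈) (proj₁ (proj₂ punched))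

          rung-solved : ∀ {e} → e ∈ edges → Satisfied (rung (proj₁ e) (colour e))
          rung-solved {u , w , c} e∈ with coloured? s (u , w , c)
          ... | yes c≡s = trans (rungColour-unmatched (rung-unmatched e∈ c≡s)) (sym c≡s)
          ... | no c≢s = begin
            rungColour u                       ≡⟨ rungColour-matched e∈M p ⟩
            punchIn s (colouring zero u w p)   ≡⟨ cong (punchIn s) (All.lookup (extends zero) reduced∋ p) ⟩
            punchIn s d                        ≡⟨ punchIn≡c ⟩
            c                                  ∎
            where
            open ≡-Reasoning
            e∈M = ∈-++⁺ʳ spareLayerEdges (∈-filter⁺ (¬? ∘ coloured? s) e∈ c≢s)
            p = All.lookup (proj₁ edges-independent) e∈
            punched = punch-≢ u w c (c≢s ∘ sym)
            d = proj₁ punched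
            punchIn≡c = proj₂ (proj₂ punched)
            reduced∋ = ∈-mapMaybe⁺ (punch s) (∈-++⁺ʳ (layerEdges zero) e∈) (proj₁ (proj₂ punched))

          solution : Σ LiftData λ D → Lift.Solves D L
          solution = liftData , (λ x → All.tabulate (layer-solved x)) ,
                                subst (All _) edges-rungs (Allₚ.map⁺ (All.tabulate rung-solved))

  one-empty-or-both-nonempty : {A : Set} (xs ys : List A) → (xs ≡ [] ⊎ ys ≡ []) ⊎ (1 ≤ length xs × 1 ≤ length ys)
  one-empty-or-both-nonempty [] _ = inj₁ (inj₁ refl)
  one-empty-or-both-nonempty (_ ∷ _) [] = inj₁ (inj₂ refl)
  one-empty-or-both-nonempty (_ ∷ _) (_ ∷ _) = inj₂ (s≤s z≤n , s≤s z≤n)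

  double-sum : ∀ c r → c + c + r + r ≡ (c + r) + (c + r)
  double-sum = solve-∀

  χ-bound : suc k ≤ χ
  χ-bound = ≤-trans (s≤s (m≤n*m k 2)) (≤-trans 2k<Δ (Δ≤colours G χ-colours))

  drop-layer : ∀ a b r → 1 ≤ b → a + b + r ≤ suc k → a + r ≤ k
  drop-layer a b r 1≤b abr≤ = ≤-pred (begin
    suc (a + r)   ≡⟨ +-comm 1 (a + r) ⟩
    a + r + 1     ≤⟨ +-monoʳ-≤ (a + r) 1≤b ⟩
    a + r + b     ≡⟨ xy∙z≈xz∙y a r b ⟩
    a + b + r     ≤⟨ abr≤ ⟩
    suc k         ∎)
    where open ≤-Reasoning

  module _ (L : Layout) (L≤ : size L ≤ suc k) where
    open Layout L
    open Finish L

    length-allLayerEdges : length allLayerEdges + length rungs ≤ suc k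
    length-allLayerEdges = subst (λ l → l + length rungs ≤ suc k) (sym (length-++ (layerEdges zero))) L≤

    witness-bound : length (endpoints allLayerEdges) + length rungs + length rungs ≤ suc (Δ G)
    witness-bound = begin
      length (endpoints allLayerEdges) + r + r ≡⟨ cong (λ l → l + r + r) (length-endpoints allLayerEdges) ⟩
      c + c + r + r                            ≡⟨ double-sum c r ⟩
      (c + r) + (c + r)                        ≤⟨ +-mono-≤ length-allLayerEdges length-allLayerEdges ⟩
      suc k + suc k                            ≡⟨ cong suc (+-suc k k) ⟩
      suc (suc (k + k))                        ≤⟨ s≤s (subst (_< Δ G) (cong (k +_) (+-identityʳ k)) 2k<Δ) ⟩
      suc (Δ G)                                ∎
      where
      open ≤-Reasoning
      c = length allLayerEdges
      r = length rungs

    W : Witnesses (endpoints allLayerEdges) rungs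
    W = witnesses (endpoints allLayerEdges) rungs rungs-distinct witness-bound

    open Witnesses W

    one-layer : layerEdges zero ≡ [] ⊎ layerEdges (suc zero) ≡ [] → Σ LiftData λ D → Lift.Solves D L
    one-layer one-empty =
      solution W s (λ _ → f) (λ _ → f-proper) extends (inj₂ (proj₂ allLayerEdges-independent)) (All.tabulate λ _ _ → refl)
      where
      allLayerEdges-independent : IndependentPrecoloring G allLayerEdges
      allLayerEdges-independent =
        [ (λ empty₀ → subst (λ l → IndependentPrecoloring G (l ++ layerEdges (suc zero))) (sym empty₀)
                            (layer-independent (suc zero)))
        , (λ empty₁ → subst (λ l → IndependentPrecoloring G (layerEdges zero ++ l)) (sym empty₁)
                            (subst (IndependentPrecoloring G) (sym (++-identityʳ _)) (layer-independent zero)))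
        ]′ one-empty

      length-all : length (allLayerEdges ++ edges) ≤ suc k
      length-all = subst (_≤ suc k)
                         (sym (trans (length-++ allLayerEdges) (cong (length allLayerEdges +_) (length-edges W))))
                         length-allLayerEdges

      s = proj₁ (spare-colour (allLayerEdges ++ edges) length-all)
      extension = extend (mapMaybe (punch s) (allLayerEdges ++ edges))
                         (punch-independent s (with-witnesses-independent W (λ e∈ → e∈) allLayerEdges-independent))
                         (proj₂ (spare-colour (allLayerEdges ++ edges) length-all))
      f = proj₁ extension
      f-proper = proj₁ (proj₂ extension)

      extends : ∀ x → All (Extends f) (reduced W s x)
      extends x = Allₚ.anti-mono (mapMaybe-mono (punch s) (Subset.++⁺ˡ edges (layer⊆allLayerEdges x)))
                                 (proj₂ (proj₂ extension))

    two-layers : 1 ≤ length (layerEdges zero) → 1 ≤ length (layerEdges (suc zero)) → Σ LiftData λ D → Lift.Solves D L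
    two-layers 1≤l₀ 1≤l₁ =
      solution W s colouring (proj₁ ∘ proj₂ ∘ extension) (proj₂ ∘ proj₂ ∘ extension)
               (inj₁ no-spare) (subst (All _) (sym no-spare) [])
      where
      l₀ = length (layerEdges zero)
      l₁ = length (layerEdges (suc zero))

      colours< : length (map colour allLayerEdges) < length (allFin (suc χ))
      colours< = begin-strict
        length (map colour allLayerEdges)    ≡⟨ length-map colour allLayerEdges ⟩
        length allLayerEdges                 ≤⟨ m≤m+n (length allLayerEdges) (length rungs) ⟩
        length allLayerEdges + length rungs  ≤⟨ length-allLayerEdges ⟩
        suc k                                ≤⟨ χ-bound ⟩
        χ                                    <⟨ ≤-refl ⟩
        suc χ                                ≡⟨ length-tabulate (λ i → i) ⟨
        length (allFin (suc χ))              ∎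
        where open ≤-Reasoning

      unused = length<⇒∃∉ _≟_ (allFin⁺ (suc χ)) colours<
      s = proj₁ unused

      no-spare : filter (coloured? s) allLayerEdges ≡ []
      no-spare = filter-none (coloured? s) (All.tabulate λ e∈ c≡s →
        proj₂ (proj₂ unused) (subst (_∈ map colour allLayerEdges) c≡s (∈-map⁺ colour e∈)))

      budget : ∀ x → length (layerEdges x) + length rungs ≤ k
      budget zero = drop-layer l₀ l₁ (length rungs) 1≤l₁ L≤
      budget (suc zero) =
        drop-layer l₁ l₀ (length rungs) 1≤l₀ (subst (_≤ suc k) (cong (_+ length rungs) (+-comm l₀ l₁)) L≤)

      extension : ∀ x → Extendable G χ (reduced W s x)
      extension x = extend (reduced W s x) (reduced-independent W s x) (≤-trans (length-reduced W s x) (budget x))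

      colouring : Fin 2 → EdgeColoring G χ
      colouring x = proj₁ (extension x)

    lift-layout : Σ LiftData λ D → Lift.Solves D L
    lift-layout with one-empty-or-both-nonempty (layerEdges zero) (layerEdges (suc zero))
    ... | inj₁ one-empty = one-layer one-empty
    ... | inj₂ (1≤l₀ , 1≤l₁) = two-layers 1≤l₀ 1≤l₁

theorem3p2 : (G : Graph) → IsSimple G → Regular G →
    (k χ : ℕ) → 2 * k < Δ G → IsChromaticIndex G χ →
    ((P : Precoloring G χ) → IndependentPrecoloring G P → length P ≤ k → Extendable G χ P) →
    (P : Precoloring (G □K₂) (suc χ)) → IndependentPrecoloring (G □K₂) P →
    length P ≤ suc k → Extendable (G □K₂) (suc χ) P
theorem3p2 G simple reg k χ 2k<Δ (χ-colours , _) extend P P-independent P≤ =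
  Lift.lifted-extends (proj₁ solution) P P-independent (proj₂ solution)
  where
  open Pieces G (suc χ) using (layout; layout-size)
  open Lifting G simple χ using (module Lift)
  open Core G simple reg k χ 2k<Δ χ-colours extend using (lift-layout)
  solution = lift-layout (layout P P-independent) (subst (_≤ suc k) (sym (layout-size P P-independent)) P≤)
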